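{- Let $m, n$ be positive integers with $n$ even, and let $k$ be an odd integer with $k \geq -f_{n-2}(m) + 1$. Put $f_h = f_h(m)$, $$s = f_n f_{n-1} + k f_{n+1}, \quad t = -f_{n-1}^2 - k f_n, \quad D = s^2 - 4t, \quad T_n = f_{n+1} s + 2 f_n.$$ Let $(x,y)$ be the minimal solution of the negative Pell equation $X^2 - DY^2 = -1$. Then: (a) if $m$ is even, $x = \frac{(T_n^2+3)T_n}{2}$ and $y = \frac{(T_n^2+1) f_{n+1}}{2}$; (b) if $m$ is odd and $n \equiv 0, 4 \pmod 6$, $x = \frac{(T_n^2+3)T_n}{2}$ and $y = \frac{(T_n^2+1) f_{n+1}}{2}$; (c) if $m$ is odd and $n \equiv 2 \pmod 6$, $x = \frac{T_n}{2}$ and $y = \frac{f_{n+1}}{2}$.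
   Context: The Fibonacci polynomials $f_h(m)$, for a fixed integer $m$, are defined by $f_0(m) = 0$, $f_1(m) = 1$, $f_h(m) = m f_{h-1}(m) + f_{h-2}(m)$ for $h \geq 2$, and $f_{ -h}(m) = (-1)^{h-1} f_h(m)$ for $h \geq 1$. The minimal solution of $X^2 - DY^2 = c$ is its solution in positive integers $(x,y)$ with $x+y\sqrt D$ smallest. -}

module Defs where

open import Data.Nat using (ℕ; zero; suc)
open import Data.Integer using (ℤ; +_; _+_; _-_; _*_; -_; _≤_; _<_; _>_)
open import Data.Product using (_×_)
open import Data.Sum using (_⊎_)

-- Fibonacci polynomials f_h(m) for h ≥ 0:
-- f_0 = 0, f_1 = 1, f_h = m f_{h-1} + f_{h-2}.
-- (Only non-negative indices are needed: n ≥ 2 since n is positive and even.)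
fib : ℤ → ℕ → ℤ
fib m zero = + 0
fib m (suc zero) = + 1
fib m (suc (suc h)) = m * fib m (suc h) + fib m h

-- Order on Z[√D] (D ≥ 0, √D the non-negative square root), without reals:
-- a + b√D ≤ a' + b'√D  iff  u ≤ v√D  where u = a - a', v = b' - b, and
-- u ≤ v√D  holds iff  (u ≤ 0 and v ≥ 0) or (u ≤ 0, v < 0 and v²D ≤ u²)
--                  or (u > 0, v > 0 and u² ≤ v²D).
≤√ : ℤ → ℤ → ℤ → Set
≤√ D u v = ((u ≤ + 0) × (+ 0 ≤ v))
         ⊎ (((u ≤ + 0) × (v < + 0)) × (v * v * D ≤ u * u))
         ⊎ (((u > + 0) × (v > + 0)) × (u * u ≤ v * v * D))

QLeq : ℤ → ℤ → ℤ → ℤ → ℤ → Set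
QLeq D a b a' b' = ≤√ D (a - a') (b' - b)

IsPosSol : ℤ → ℤ → ℤ → ℤ → Set
IsPosSol D c x y = (x > + 0) × (y > + 0) × (x * x - D * (y * y) ≡ c)
  where open import Relation.Binary.PropositionalEquality using (_≡_)

IsMinimalSol : ℤ → ℤ → ℤ → ℤ → Set
IsMinimalSol D c x y =
  IsPosSol D c x y × (∀ x' y' → IsPosSol D c x' y' → QLeq D x y x' y')

-- With f = f_{n+1} and T = T_n, Cassini's identity f_{n+1} f_{n-1} − f_n² = 1 gives D f² = T² + 4,
-- so (T + f√D)/2 has norm −1, and the bound on k gives f² < T. These two facts alone force the
-- minimal solution: a solution p² − D q² = −4 with 0 < q < f would, after multiplication by f²,
-- give (p f)² + 4 f² = (q T)² + 4 q², which is impossible once f² < T. So every solution of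
-- x² − D y² = −1 has 2y ≥ f. When T and f are even, (T/2, f/2) attains this bound. When T is odd,
-- (T + f√D)/2 is not integral; its cube ((T² + 3)T + (T² + 1)f√D)/2 is, and any integral
-- solution with f < 2y < (T² + 1) f, divided by the square of (T + f√D)/2, would give a solution of
-- norm −4 with 0 < q < f. Which case occurs is decided by the parities of f_n, f_{n+1} and k.
module Submission where

open import Data.Nat using (ℕ; zero; suc; _∸_; _%_; _/_)
import Data.Nat.Base as ℕ
import Data.Nat.Properties as ℕ
import Data.Nat.DivMod as ℕ
import Data.Nat.Divisibility as ℕ
open import Data.Product using (_×_; _,_; ∃-syntax)
open import Data.Sum using (_⊎_; inj₁; inj₂)
open import Data.Empty using (⊥; ⊥-elim)
open import Data.List.Base using (_∷_; [])
open import Relation.Nullary using (¬_)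
open import Relation.Binary.PropositionalEquality
open import Defs

module _ where
  open import Data.Nat
  open import Data.Nat.Properties
  open import Data.Nat.Tactic.RingSolver using (solve-∀)

  -- Writing Y = X + d, the equation becomes d (2X + d) + 4Q² = 4F²: odd d contradicts parity,
  -- d = 2 gives F² = X + 1 + Q² ≥ Y, and d ≥ 4 gives 4Y ≤ d (2X + d) ≤ 4F².
  x²+4f²≢y²+4q² : ∀ {X Y F Q} → 1 ≤ Q → Q < F → F * F < Y →
                  X * X + 4 * (F * F) ≢ Y * Y + 4 * (Q * Q)
  x²+4f²≢y²+4q² {X} {Y} {F} {Q} 1≤Q Q<F F²<Y eq =
    let d , X+d≡Y = m≤n⇒∃[o]m+o≡n X≤Y in excess d X+d≡Y (gap d X+d≡Y)
    where
    4Q²<4F² : 4 * (Q * Q) < 4 * (F * F)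
    4Q²<4F² = *-monoʳ-< 4 (*-mono-< Q<F Q<F)

    X≤Y : X ≤ Y
    X≤Y = ≮⇒≥ λ Y<X →
      <⇒≢ (+-mono-≤-< (*-mono-≤ (<⇒≤ Y<X) (<⇒≤ Y<X)) 4Q²<4F²) (sym eq)

    gap : ∀ d → X + d ≡ Y → d * (2 * X + d) + 4 * (Q * Q) ≡ 4 * (F * F)
    gap d X+d≡Y = +-cancelˡ-≡ (X * X) _ _ (begin
      X * X + (d * (2 * X + d) + 4 * (Q * Q)) ≡⟨ expand X d (Q * Q) ⟩
      (X + d) * (X + d) + 4 * (Q * Q)         ≡⟨ cong (λ z → z * z + 4 * (Q * Q)) X+d≡Y ⟩
      Y * Y + 4 * (Q * Q)                     ≡⟨ sym eq ⟩
      X * X + 4 * (F * F)                     ∎)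
      where
      open ≡-Reasoning
      expand : ∀ x d q → x * x + (d * (2 * x + d) + 4 * q) ≡ (x + d) * (x + d) + 4 * q
      expand = solve-∀

    excess : ∀ d → X + d ≡ Y → d * (2 * X + d) + 4 * (Q * Q) ≢ 4 * (F * F)
    excess 0 _ e = <⇒≢ 4Q²<4F² e
    excess 1 _ e = even≢odd (2 * (F * F)) (X + 2 * (Q * Q))
      (trans (sym (*-assoc 2 2 (F * F))) (trans (sym e) (odd₁ X (Q * Q))))
      where
      odd₁ : ∀ x q → 1 * (2 * x + 1) + 4 * q ≡ suc (2 * (x + 2 * q))
      odd₁ = solve-∀
    excess 2 X+2≡Y e = <⇒≱ F²<Y (begin
      Y              ≡⟨ sym X+2≡Y ⟩
      X + 2          ≡⟨ sym (+-assoc X 1 1) ⟩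
      X + 1 + 1      ≤⟨ +-monoʳ-≤ (X + 1) (*-mono-≤ 1≤Q 1≤Q) ⟩
      X + 1 + Q * Q  ≡⟨ *-cancelˡ-≡ (X + 1 + Q * Q) (F * F) 4 (trans (even₂ X (Q * Q)) e) ⟩
      F * F          ∎)
      where
      open ≤-Reasoning
      even₂ : ∀ x q → 4 * (x + 1 + q) ≡ 2 * (2 * x + 2) + 4 * q
      even₂ = solve-∀
    excess 3 _ e = even≢odd (2 * (F * F)) (3 * X + 4 + 2 * (Q * Q))
      (trans (sym (*-assoc 2 2 (F * F))) (trans (sym e) (odd₃ X (Q * Q))))
      where
      odd₃ : ∀ x q → 3 * (2 * x + 3) + 4 * q ≡ suc (2 * (3 * x + 4 + 2 * q))
      odd₃ = solve-∀
    excess d@(suc (suc (suc (suc r)))) X+d≡Y e = <⇒≱ (*-monoʳ-< 4 F²<Y) (begin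
      4 * Y                         ≡⟨ cong (4 *_) (sym X+d≡Y) ⟩
      4 * (X + d)                   ≤⟨ *-mono-≤ (m≤m+n 4 r) (+-monoˡ-≤ d (m≤m+n X (1 * X))) ⟩
      d * (2 * X + d)               ≤⟨ m≤m+n _ _ ⟩
      d * (2 * X + d) + 4 * (Q * Q) ≡⟨ e ⟩
      4 * (F * F)                   ∎)
      where open ≤-Reasoning

open import Data.Integer
  using (ℤ; +_; -[1+_]; _+_; _-_; _*_; -_; _≤_; _<_; ∣_∣; +≤+; +<+; -≤+; positive; nonNegative)
open import Data.Integer.Properties
import Data.Integer.DivMod as ℤ
open import Data.Integer.Divisibility using (_∣_)
open import Data.Integer.Divisibility.Signed using (divides; ∣⇒∣ᵤ)
open import Data.Integer.Tactic.RingSolver using (solve)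

square-abs : ∀ i → i * i ≡ + ∣ i ∣ * + ∣ i ∣
square-abs (+ zero)  = refl
square-abs (+ suc n) = refl
square-abs -[1+ n ]  = refl

0≤i*i : ∀ i → + 0 ≤ i * i
0≤i*i i = subst (+ 0 ≤_) (sym (trans (square-abs i) (sym (pos-* ∣ i ∣ ∣ i ∣)))) (+≤+ ℕ.z≤n)

0≤i*j : ∀ {i j} → + 0 ≤ i → + 0 ≤ j → + 0 ≤ i * j
0≤i*j {+ m} {+ n} _ _ = subst (+ 0 ≤_) (pos-* m n) (+≤+ ℕ.z≤n)

0<i*j : ∀ {i j} → + 0 < i → + 0 < j → + 0 < i * j
0<i*j {+ suc m} {+ suc n} _ _ = +<+ (ℕ.s≤s ℕ.z≤n)
0<i*j {+ zero} (+<+ ())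
0<i*j {+ suc m} {+ zero} _ (+<+ ())

0<2*i⇒0<i : ∀ {i} → + 0 < + 2 * i → + 0 < i
0<2*i⇒0<i {+ suc n}  _ = +<+ (ℕ.s≤s ℕ.z≤n)
0<2*i⇒0<i {+ zero}   (+<+ ())
0<2*i⇒0<i { -[1+ n ]} ()

square-mono-< : ∀ {i j} → + 0 ≤ i → i < j → i * i < j * j
square-mono-< {+ m} {+ n} _ (+<+ m<n) =
  subst₂ _<_ (pos-* m m) (pos-* n n) (+<+ (ℕ.*-mono-< m<n m<n))

square-mono-≤ : ∀ {i j} → + 0 ≤ i → i ≤ j → i * i ≤ j * j
square-mono-≤ {+ m} {+ n} _ (+≤+ m≤n) =
  subst₂ _≤_ (pos-* m m) (pos-* n n) (+≤+ (ℕ.*-mono-≤ m≤n m≤n))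

square-cancel-< : ∀ {i j} → + 0 ≤ j → i * i < j * j → i < j
square-cancel-< 0≤j i²<j² = ≰⇒> λ j≤i → <⇒≱ i²<j² (square-mono-≤ 0≤j j≤i)

square-injective : ∀ {i j} → + 0 ≤ i → + 0 ≤ j → i * i ≡ j * j → i ≡ j
square-injective 0≤i 0≤j eq = ≤-antisym
  (≮⇒≥ λ j<i → <⇒≢ (square-mono-< 0≤j j<i) (sym eq))
  (≮⇒≥ λ i<j → <⇒≢ (square-mono-< 0≤i i<j) eq)

i<j⇒0<j-i : ∀ {i j} → i < j → + 0 < j - i
i<j⇒0<j-i {i} {j} i<j = subst (_< j - i) (+-inverseʳ i) (+-monoˡ-< (- i) i<j)

0<j-i⇒i<j : ∀ {i j} → + 0 < j - i → i < j
0<j-i⇒i<j {i} {j} 0<j-i = subst₂ _<_ (+-identityˡ i) (j-i+i≡j i j) (+-monoˡ-< i 0<j-i)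
  where
  j-i+i≡j : ∀ i j → j - i + i ≡ j
  j-i+i≡j i j = solve (i ∷ j ∷ [])

norm-rearrange : ∀ {D x y c} → x * x - D * (y * y) ≡ c → x * x ≡ D * (y * y) + c
norm-rearrange {D} {x} {y} refl = solve (D ∷ x ∷ y ∷ [])

norm-double : ∀ {D x y c} → x * x - D * (y * y) ≡ c →
              (+ 2 * x) * (+ 2 * x) - D * ((+ 2 * y) * (+ 2 * y)) ≡ + 4 * c
norm-double {D} {x} {y} refl = solve (D ∷ x ∷ y ∷ [])

norm-halve : ∀ {D x y c} → (+ 2 * x) * (+ 2 * x) - D * ((+ 2 * y) * (+ 2 * y)) ≡ + 4 * c →
             x * x - D * (y * y) ≡ c
norm-halve {D} {x} {y} eq = *-cancelˡ-≡ (+ 4) _ _ (trans (sym (norm-double {D} {x} {y} refl)) eq)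

¬QLeq-larger : ∀ {D a b a′ b′} → a′ < a → b′ < b → ¬ QLeq D a b a′ b′
¬QLeq-larger a′<a _ (inj₁ (a-a′≤0 , _))              = <⇒≱ a′<a (i-j≤0⇒i≤j a-a′≤0)
¬QLeq-larger a′<a _ (inj₂ (inj₁ ((a-a′≤0 , _) , _))) = <⇒≱ a′<a (i-j≤0⇒i≤j a-a′≤0)
¬QLeq-larger _ b′<b (inj₂ (inj₂ ((_ , 0<b′-b) , _)))  = <⇒≱ b′<b (0≤i-j⇒j≤i (<⇒≤ 0<b′-b))

pos-sol-mono : ∀ {D c x y X Y} → + 0 < D → IsPosSol D c x y → IsPosSol D c X Y → Y < y → X < x
pos-sol-mono {D} {c} {x} {y} {X} {Y} 0<D (0<x , _ , x-norm) (_ , 0<Y , X-norm) Y<y =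
  square-cancel-< (<⇒≤ 0<x)
    (subst₂ _<_ (sym (norm-rearrange {D} {X} {Y} X-norm)) (sym (norm-rearrange {D} {x} {y} x-norm))
      (+-monoˡ-< c (*-monoˡ-<-pos D ⦃ positive 0<D ⦄ (square-mono-< (<⇒≤ 0<Y) Y<y))))

minimal-sol-least-y : ∀ {D c x y X Y} → + 0 < D → IsMinimalSol D c x y → IsPosSol D c X Y → y ≤ Y
minimal-sol-least-y 0<D (sol , least) sol′ =
  ≮⇒≥ λ Y<y → ¬QLeq-larger (pos-sol-mono 0<D sol sol′ Y<y) Y<y (least _ _ sol′)

minimal-sol-unique : ∀ {D c x y X Y} → + 0 < D → IsMinimalSol D c x y → IsPosSol D c X Y →
                     Y ≤ y → x ≡ X × y ≡ Y
minimal-sol-unique {D} {c} {x} {y} {X} {Y} 0<D minimal@((0<x , _ , x-norm) , _) sol′@(0<X , _ , X-norm) Y≤y =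
  square-injective (<⇒≤ 0<x) (<⇒≤ 0<X) (begin
    x * x           ≡⟨ norm-rearrange {D} {x} {y} x-norm ⟩
    D * (y * y) + c ≡⟨ cong (λ z → D * (z * z) + c) y≡Y ⟩
    D * (Y * Y) + c ≡⟨ sym (norm-rearrange {D} {X} {Y} X-norm) ⟩
    X * X           ∎)
  , y≡Y
  where
  open ≡-Reasoning
  y≡Y : y ≡ Y
  y≡Y = ≤-antisym (minimal-sol-least-y 0<D minimal sol′) Y≤y

brahmagupta : ∀ D x y R S →
  (x * R - D * (y * S)) * (x * R - D * (y * S)) - D * ((y * R - x * S) * (y * R - x * S))
    ≡ (x * x - D * (y * y)) * (R * R - D * (S * S))
brahmagupta D x y R S = solve (D ∷ x ∷ y ∷ R ∷ S ∷ [])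

scaled-norm : ∀ {D f T p q} → D * (f * f) ≡ T * T + + 4 → p * p - D * (q * q) ≡ - + 4 →
              (p * f) * (p * f) + + 4 * (f * f) ≡ (q * T) * (q * T) + + 4 * (q * q)
scaled-norm {D} {f} {T} {p} {q} D-eq norm = begin
  (p * f) * (p * f) + + 4 * (f * f)
    ≡⟨ solve (D ∷ f ∷ p ∷ q ∷ []) ⟩
  (p * p - D * (q * q)) * (f * f) + + 4 * (f * f) + (q * q) * (D * (f * f))
    ≡⟨ cong₂ (λ a b → a * (f * f) + + 4 * (f * f) + (q * q) * b) norm D-eq ⟩
  - + 4 * (f * f) + + 4 * (f * f) + (q * q) * (T * T + + 4)
    ≡⟨ solve (f ∷ T ∷ q ∷ []) ⟩
  (q * T) * (q * T) + + 4 * (q * q) ∎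
  where open ≡-Reasoning

no-small-norm-4 : ∀ {D f T q} p → D * (f * f) ≡ T * T + + 4 → f * f < T →
                  + 0 < q → q < f → p * p - D * (q * q) ≢ - + 4
no-small-norm-4 {D} {+ F} {+ T} {+ Q} p D-eq f²<T (+<+ 1≤Q) (+<+ Q<F) norm =
  x²+4f²≢y²+4q² {X} {Q ℕ.* T} 1≤Q Q<F F²<QT (+-injective (begin
    + (X ℕ.* X ℕ.+ 4 ℕ.* (F ℕ.* F))
      ≡⟨ pos-sum X F ⟩
    + X * + X + + 4 * (+ F * + F)
      ≡⟨ cong (_+ + 4 * (+ F * + F)) (sym (square-abs (p * + F))) ⟩
    (p * + F) * (p * + F) + + 4 * (+ F * + F)
      ≡⟨ scaled-norm {D} {+ F} {+ T} {p} {+ Q} D-eq norm ⟩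
    (+ Q * + T) * (+ Q * + T) + + 4 * (+ Q * + Q)
      ≡⟨ cong (λ z → z * z + + 4 * (+ Q * + Q)) (sym (pos-* Q T)) ⟩
    + (Q ℕ.* T) * + (Q ℕ.* T) + + 4 * (+ Q * + Q)
      ≡⟨ sym (pos-sum (Q ℕ.* T) Q) ⟩
    + (Q ℕ.* T ℕ.* (Q ℕ.* T) ℕ.+ 4 ℕ.* (Q ℕ.* Q)) ∎))
  where
  open ≡-Reasoning
  X : ℕ
  X = ∣ p * + F ∣
  pos-sum : ∀ a b → + (a ℕ.* a ℕ.+ 4 ℕ.* (b ℕ.* b)) ≡ + a * + a + + 4 * (+ b * + b)
  pos-sum a b = trans (pos-+ (a ℕ.* a) _) (cong₂ _+_ (pos-* a a)
                  (trans (pos-* 4 (b ℕ.* b)) (cong (+ 4 *_) (pos-* b b))))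
  F²<QT : F ℕ.* F ℕ.< Q ℕ.* T
  F²<QT = ℕ.<-≤-trans (drop‿+<+ (subst (_< + T) (sym (pos-* F F)) f²<T))
                      (ℕ.m≤n*m T Q ⦃ ℕ.>-nonZero 1≤Q ⦄)
no-small-norm-4 {f = f} {T = -[1+ _ ]} _ _ f²<T _ _ _ = <⇒≱ f²<T (≤-trans -≤+ (0≤i*i f))
no-small-norm-4 {q = -[1+ _ ]} _ _ _ () _
no-small-norm-4 {f = -[1+ _ ]} {q = + _} _ _ _ _ ()

Even Odd : ℤ → Set
Even i = ∃[ w ] i ≡ + 2 * w
Odd i = ∃[ w ] i ≡ + 1 + + 2 * w

even+even : ∀ {i j} → Even i → Even j → Even (i + j)
even+even (a , refl) (b , refl) = a + b , solve (a ∷ b ∷ [])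

even+odd : ∀ {i j} → Even i → Odd j → Odd (i + j)
even+odd (a , refl) (b , refl) = a + b , solve (a ∷ b ∷ [])

odd+even : ∀ {i j} → Odd i → Even j → Odd (i + j)
odd+even (a , refl) (b , refl) = a + b , solve (a ∷ b ∷ [])

odd+odd : ∀ {i j} → Odd i → Odd j → Even (i + j)
odd+odd (a , refl) (b , refl) = + 1 + a + b , solve (a ∷ b ∷ [])

even* : ∀ {i j} → Even i → Even (i * j)
even* {j = j} (a , refl) = a * j , solve (a ∷ j ∷ [])

*even : ∀ {i j} → Even j → Even (i * j)
*even {i} (b , refl) = i * b , solve (i ∷ b ∷ [])

odd*odd : ∀ {i j} → Odd i → Odd j → Odd (i * j)
odd*odd (a , refl) (b , refl) = a + b + + 2 * a * b , solve (a ∷ b ∷ [])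

even⇒¬odd : ∀ {i} → Even i → ¬ Odd i
even⇒¬odd (a , refl) (b , 2a≡1+2b) =
  ℕ.even≢odd ∣ a - b ∣ 0 (trans (sym (abs-* (+ 2) (a - b))) (cong ∣_∣ 2[a-b]≡1))
  where
  open ≡-Reasoning
  2[a-b]≡1 : + 2 * (a - b) ≡ + 1
  2[a-b]≡1 = begin
    + 2 * (a - b)           ≡⟨ solve (a ∷ b ∷ []) ⟩
    + 2 * a - + 2 * b       ≡⟨ cong (_- + 2 * b) 2a≡1+2b ⟩
    + 1 + + 2 * b - + 2 * b ≡⟨ solve (b ∷ []) ⟩
    + 1                     ∎

module MinimalSolution (D f T : ℤ) (D-eq : D * (f * f) ≡ T * T + + 4)
                       (0<f : + 0 < f) (f²<T : f * f < T) where

  0<T : + 0 < T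
  0<T = ≤-<-trans (0≤i*i f) f²<T

  0≤T : + 0 ≤ T
  0≤T = <⇒≤ 0<T

  0<D : + 0 < D
  0<D = *-cancelʳ-<-nonNeg (f * f) ⦃ nonNegative (0≤i*i f) ⦄ 0<Df²
    where
    0<Df² : + 0 * (f * f) < D * (f * f)
    0<Df² = subst (+ 0 <_) (sym D-eq) (+-mono-≤-< (0≤i*i T) (+<+ (ℕ.s≤s ℕ.z≤n)))

  T²-Df²≡-4 : T * T - D * (f * f) ≡ - + 4
  T²-Df²≡-4 = trans (cong (λ z → T * T - z) D-eq) (solve (T ∷ []))

  norm-4-at-f : ∀ {p} → + 0 ≤ p → p * p - D * (f * f) ≡ - + 4 → p ≡ T
  norm-4-at-f {p} 0≤p norm = square-injective 0≤p 0≤T (begin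
    p * p                 ≡⟨ norm-rearrange {D} {p} {f} norm ⟩
    D * (f * f) + - + 4   ≡⟨ cong (_+ - + 4) D-eq ⟩
    T * T + + 4 + - + 4   ≡⟨ solve (T ∷ []) ⟩
    T * T                 ∎)
    where open ≡-Reasoning

  f≤2y : ∀ {x y} → IsPosSol D (- + 1) x y → f ≤ + 2 * y
  f≤2y {x} {y} (_ , 0<y , norm) = ≮⇒≥ λ 2y<f →
    no-small-norm-4 {D} {f} {T} {+ 2 * y} (+ 2 * x) D-eq f²<T
      (0<i*j {+ 2} (+<+ (ℕ.s≤s ℕ.z≤n)) 0<y) 2y<f (norm-double {D} {x} {y} norm)

  minimal-solution-even : ∀ {x y} → Even T → Even f → IsMinimalSol D (- + 1) x y →
                          (+ 2 * x ≡ T) × (+ 2 * y ≡ f)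
  minimal-solution-even {x} {y} (j , T≡2j) (g , f≡2g) minimal@(sol , _) =
    let x≡j , y≡g = minimal-sol-unique 0<D minimal half g≤y
    in trans (cong (+ 2 *_) x≡j) (sym T≡2j) , trans (cong (+ 2 *_) y≡g) (sym f≡2g)
    where
    half : IsPosSol D (- + 1) j g
    half = 0<2*i⇒0<i (subst (+ 0 <_) T≡2j 0<T) , 0<2*i⇒0<i (subst (+ 0 <_) f≡2g 0<f)
         , norm-halve {D} {j} {g} (subst₂ (λ P Q → P * P - D * (Q * Q) ≡ - + 4) T≡2j f≡2g T²-Df²≡-4)
    g≤y : g ≤ y
    g≤y = *-cancelˡ-≤-pos g y (+ 2) (subst (_≤ + 2 * y) f≡2g (f≤2y sol))

  R S : ℤ
  R = T * T + + 2
  S = T * f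

  -- R + S√D = (T + f√D)²/2
  unit-norm : R * R - D * (S * S) ≡ + 4
  unit-norm = begin
    (T * T + + 2) * (T * T + + 2) - D * ((T * f) * (T * f))
      ≡⟨ solve (D ∷ T ∷ f ∷ []) ⟩
    (T * T + + 2) * (T * T + + 2) - T * T * (D * (f * f))
      ≡⟨ cong (λ z → (T * T + + 2) * (T * T + + 2) - T * T * z) D-eq ⟩
    (T * T + + 2) * (T * T + + 2) - T * T * (T * T + + 4)
      ≡⟨ solve (T ∷ []) ⟩
    + 4 ∎
    where open ≡-Reasoning

  xS<yR : ∀ {x y} → IsPosSol D (- + 1) x y → x * S < y * R
  xS<yR {x} {y} (_ , 0<y , norm) =
    square-cancel-< (0≤i*j (<⇒≤ 0<y) (<⇒≤ 0<R))
      (0<j-i⇒i<j (subst (+ 0 <_) (sym gap) (+-mono-<-≤ 0<4y² (0≤i*i S))))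
    where
    open ≡-Reasoning
    0<R : + 0 < R
    0<R = +-mono-≤-< (0≤i*i T) (+<+ (ℕ.s≤s ℕ.z≤n))
    0<4y² : + 0 < + 4 * (y * y)
    0<4y² = 0<i*j {+ 4} (+<+ (ℕ.s≤s ℕ.z≤n)) (0<i*j 0<y 0<y)
    expand : ∀ x y R S → (y * R) * (y * R) - (x * S) * (x * S)
                         ≡ y * y * (R * R - D * (S * S)) - (x * x - D * (y * y)) * (S * S)
    expand x y R S = solve (D ∷ x ∷ y ∷ R ∷ S ∷ [])
    simplify : ∀ y S → y * y * + 4 - (- + 1) * (S * S) ≡ + 4 * (y * y) + S * S
    simplify y S = solve (y ∷ S ∷ [])
    gap : (y * R) * (y * R) - (x * S) * (x * S) ≡ + 4 * (y * y) + S * S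
    gap = begin
      (y * R) * (y * R) - (x * S) * (x * S)
        ≡⟨ expand x y R S ⟩
      y * y * (R * R - D * (S * S)) - (x * x - D * (y * y)) * (S * S)
        ≡⟨ cong₂ (λ a b → y * y * a - b * (S * S)) unit-norm norm ⟩
      y * y * + 4 - (- + 1) * (S * S)
        ≡⟨ simplify y S ⟩
      + 4 * (y * y) + S * S ∎

  yR-f<xS : ∀ {x y} → IsPosSol D (- + 1) x y → f < + 2 * y → + 2 * y < (T * T + + 1) * f →
            y * R - f < x * S
  yR-f<xS {x} {y} (0<x , _ , norm) f<2y 2y<[T²+1]f =
    square-cancel-< (0≤i*j (<⇒≤ 0<x) (0≤i*j 0≤T (<⇒≤ 0<f)))
      (0<j-i⇒i<j (subst (+ 0 <_) (sym gap) (0<i*j (i<j⇒0<j-i f<2y) (i<j⇒0<j-i 2y<[T²+1]f))))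
    where
    open ≡-Reasoning
    expand : ∀ x y R S → (x * S) * (x * S) - (y * R - f) * (y * R - f)
                         ≡ (x * x - D * (y * y)) * (S * S) - y * y * (R * R - D * (S * S))
                           + + 2 * y * R * f - f * f
    expand x y R S = solve (D ∷ f ∷ x ∷ y ∷ R ∷ S ∷ [])
    simplify : ∀ y → (- + 1) * ((T * f) * (T * f)) - y * y * + 4 + + 2 * y * (T * T + + 2) * f - f * f
                     ≡ (+ 2 * y - f) * ((T * T + + 1) * f - + 2 * y)
    simplify y = solve (f ∷ T ∷ y ∷ [])
    gap : (x * S) * (x * S) - (y * R - f) * (y * R - f) ≡ (+ 2 * y - f) * ((T * T + + 1) * f - + 2 * y)
    gap = begin
      (x * S) * (x * S) - (y * R - f) * (y * R - f)
        ≡⟨ expand x y R S ⟩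
      (x * x - D * (y * y)) * (S * S) - y * y * (R * R - D * (S * S)) + + 2 * y * R * f - f * f
        ≡⟨ cong₂ (λ a b → a * (S * S) - y * y * b + + 2 * y * R * f - f * f) norm unit-norm ⟩
      (- + 1) * (S * S) - y * y * + 4 + + 2 * y * R * f - f * f
        ≡⟨ simplify y ⟩
      (+ 2 * y - f) * ((T * T + + 1) * f - + 2 * y) ∎

  -- (x + y√D)(R − S√D) is a solution of norm −4 with 0 < q < f.
  no-solution-between : ∀ {x y} → IsPosSol D (- + 1) x y →
                        f < + 2 * y → + 2 * y < (T * T + + 1) * f → ⊥
  no-solution-between {x} {y} sol@(_ , _ , norm) f<2y 2y<[T²+1]f =
    no-small-norm-4 {D} {f} {T} {y * R - x * S} (x * R - D * (y * S)) D-eq f²<T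
      (i<j⇒0<j-i (xS<yR sol)) q<f (trans (brahmagupta D x y R S) (cong₂ _*_ norm unit-norm))
    where
    rearrange : ∀ u v → v - (u - f) ≡ f - (u - v)
    rearrange u v = solve (f ∷ u ∷ v ∷ [])
    q<f : y * R - x * S < f
    q<f = 0<j-i⇒i<j (subst (+ 0 <_) (rearrange (y * R) (x * S))
            (i<j⇒0<j-i (yR-f<xS sol f<2y 2y<[T²+1]f)))

  cube-bound : ∀ {x y} → Odd T → IsPosSol D (- + 1) x y → (T * T + + 1) * f ≤ + 2 * y
  cube-bound {x} {y} T-odd sol@(0<x , _ , norm) = ≮⇒≥ (no-solution-between sol f<2y)
    where
    2x≡T : f ≡ + 2 * y → + 2 * x ≡ T
    2x≡T f≡2y = norm-4-at-f (0≤i*j {+ 2} (+≤+ ℕ.z≤n) (<⇒≤ 0<x))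
      (subst (λ q → (+ 2 * x) * (+ 2 * x) - D * (q * q) ≡ - + 4) (sym f≡2y) (norm-double {D} {x} {y} norm))
    f<2y : f < + 2 * y
    f<2y = ≤∧≢⇒< (f≤2y sol) λ f≡2y → even⇒¬odd (x , refl) (subst Odd (sym (2x≡T f≡2y)) T-odd)

  cube-norm : ((T * T + + 3) * T) * ((T * T + + 3) * T) - D * (((T * T + + 1) * f) * ((T * T + + 1) * f))
              ≡ - + 4
  cube-norm = begin
    ((T * T + + 3) * T) * ((T * T + + 3) * T) - D * (((T * T + + 1) * f) * ((T * T + + 1) * f))
      ≡⟨ solve (D ∷ T ∷ f ∷ []) ⟩
    ((T * T + + 3) * T) * ((T * T + + 3) * T) - (T * T + + 1) * (T * T + + 1) * (D * (f * f))
      ≡⟨ cong (λ z → ((T * T + + 3) * T) * ((T * T + + 3) * T) - (T * T + + 1) * (T * T + + 1) * z) D-eq ⟩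
    ((T * T + + 3) * T) * ((T * T + + 3) * T) - (T * T + + 1) * (T * T + + 1) * (T * T + + 4)
      ≡⟨ solve (T ∷ []) ⟩
    - + 4 ∎
    where open ≡-Reasoning

  cube-solution : Odd T → ∃[ X ] ∃[ Y ] IsPosSol D (- + 1) X Y
                    × ((T * T + + 3) * T ≡ + 2 * X) × ((T * T + + 1) * f ≡ + 2 * Y)
  cube-solution T-odd =
    let X , P≡2X = even* {j = T} (odd+odd T²-odd (+ 1 , refl))
        Y , Q≡2Y = even* {j = f} (odd+odd T²-odd (+ 0 , refl))
    in X , Y
     , ( 0<2*i⇒0<i (subst (+ 0 <_) P≡2X (0<i*j (+-mono-≤-< (0≤i*i T) (+<+ (ℕ.s≤s ℕ.z≤n))) 0<T))
       , 0<2*i⇒0<i (subst (+ 0 <_) Q≡2Y (0<i*j (+-mono-≤-< (0≤i*i T) (+<+ (ℕ.s≤s ℕ.z≤n))) 0<f))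
       , norm-halve {D} {X} {Y} (subst₂ (λ P Q → P * P - D * (Q * Q) ≡ - + 4) P≡2X Q≡2Y cube-norm))
     , P≡2X , Q≡2Y
    where
    T²-odd : Odd (T * T)
    T²-odd = odd*odd T-odd T-odd

  minimal-solution-odd : ∀ {x y} → Odd T → IsMinimalSol D (- + 1) x y →
                         (+ 2 * x ≡ (T * T + + 3) * T) × (+ 2 * y ≡ (T * T + + 1) * f)
  minimal-solution-odd {x} {y} T-odd minimal@(sol , _) =
    let X , Y , cube , P≡2X , Q≡2Y = cube-solution T-odd
        Y≤y = *-cancelˡ-≤-pos Y y (+ 2) (subst (_≤ + 2 * y) Q≡2Y (cube-bound T-odd sol))
        x≡X , y≡Y = minimal-sol-unique 0<D minimal cube Y≤y
    in trans (cong (+ 2 *_) x≡X) (sym P≡2X) , trans (cong (+ 2 *_) y≡Y) (sym Q≡2Y)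

fib-nonneg : ∀ m i → + 0 ≤ fib (+ m) i
fib-nonneg m zero          = +≤+ ℕ.z≤n
fib-nonneg m (suc zero)    = +≤+ ℕ.z≤n
fib-nonneg m (suc (suc i)) = +-mono-≤ (0≤i*j {+ m} (+≤+ ℕ.z≤n) (fib-nonneg m (suc i))) (fib-nonneg m i)

fib-pos : ∀ {m} → 1 ℕ.≤ m → ∀ i → + 0 < fib (+ m) (suc i)
fib-pos _       zero    = +<+ (ℕ.s≤s ℕ.z≤n)
fib-pos {m} 1≤m (suc i) = +-mono-<-≤ (0<i*j (+<+ 1≤m) (fib-pos 1≤m i)) (fib-nonneg m i)

cassini-defect : ℤ → ℕ → ℤ
cassini-defect M i = fib M (suc (suc i)) * fib M i - fib M (suc i) * fib M (suc i)

cassini-defect-suc : ∀ M i → cassini-defect M (suc i) ≡ - cassini-defect M i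
cassini-defect-suc M i = step M (fib M i) (fib M (suc i))
  where
  step : ∀ M u v → (M * (M * v + u) + v) * v - (M * v + u) * (M * v + u) ≡ - ((M * v + u) * u - v * v)
  step M u v = solve (M ∷ u ∷ v ∷ [])

cassini : ∀ M h → h % 2 ≡ 0 → cassini-defect M (suc h) ≡ + 1
cassini M zero _ = base M
  where
  base : ∀ M → (M * (M * + 1 + + 0) + + 1) * + 1 - (M * + 1 + + 0) * (M * + 1 + + 0) ≡ + 1
  base M = solve (M ∷ [])
cassini M (suc (suc h)) h-even = begin
  cassini-defect M (3 ℕ.+ h)       ≡⟨ cassini-defect-suc M (2 ℕ.+ h) ⟩
  - cassini-defect M (2 ℕ.+ h)     ≡⟨ cong -_ (cassini-defect-suc M (suc h)) ⟩
  - - cassini-defect M (suc h)     ≡⟨ neg-involutive _ ⟩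
  cassini-defect M (suc h)         ≡⟨ cassini M h h-even ⟩
  + 1                              ∎
  where open ≡-Reasoning

fib-parity-M-even : ∀ {M} → Even M → ∀ n → n % 2 ≡ 0 → Even (fib M n) × Odd (fib M (suc n))
fib-parity-M-even M-even zero          _      = (+ 0 , refl) , (+ 0 , refl)
fib-parity-M-even M-even (suc (suc n)) n-even =
  let fₙ-even , fₙ₊₁-odd = fib-parity-M-even M-even n n-even
  in even+even (even* M-even) fₙ-even , even+odd (even* M-even) fₙ₊₁-odd

fib-parity-M-odd : ∀ {M} → Odd M → ∀ {i} → 3 ℕ.∣ i →
                   Even (fib M i) × Odd (fib M (suc i)) × Odd (fib M (suc (suc i)))
fib-parity-M-odd M-odd (ℕ.divides zero refl) =
  (+ 0 , refl) , (+ 0 , refl) , odd+even (odd*odd M-odd (+ 0 , refl)) (+ 0 , refl)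
fib-parity-M-odd {M} M-odd (ℕ.divides (suc q) refl) =
  let _ , f₁-odd , f₂-odd = fib-parity-M-odd M-odd (ℕ.divides q refl)
      f₃-even = odd+odd (odd*odd M-odd f₂-odd) f₁-odd
      f₄-odd = even+odd (*even {M} f₃-even) f₂-odd
  in f₃-even , f₄-odd , odd+even (odd*odd M-odd f₄-odd) f₃-even

m%n≡r⇒m≡r+[m/n]*n : ∀ m n .⦃ _ : ℕ.NonZero n ⦄ {r} → m % n ≡ r → m ≡ r ℕ.+ m / n ℕ.* n
m%n≡r⇒m≡r+[m/n]*n m n refl = ℕ.m≡m%n+[m/n]*n m n

3∣j+n : ∀ n j {r} → n % 6 ≡ r → 3 ℕ.∣ j ℕ.+ r → 3 ℕ.∣ j ℕ.+ n
3∣j+n n j {r} n%6≡r 3∣j+r =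
  subst (3 ℕ.∣_) (sym j+n≡) (ℕ.∣m∣n⇒∣m+n 3∣j+r (ℕ.∣-trans (ℕ.divides 2 refl) (ℕ.n∣m*n (n / 6))))
  where
  j+n≡ : j ℕ.+ n ≡ j ℕ.+ r ℕ.+ n / 6 ℕ.* 6
  j+n≡ = trans (cong (j ℕ.+_) (m%n≡r⇒m≡r+[m/n]*n n 6 n%6≡r)) (sym (ℕ.+-assoc j r _))

%2≡0⇒even : ∀ m → m % 2 ≡ 0 → Even (+ m)
%2≡0⇒even m m%2≡0 = + (m / 2) ,
  trans (cong +_ (trans (m%n≡r⇒m≡r+[m/n]*n m 2 m%2≡0) (ℕ.*-comm (m / 2) 2))) (pos-* 2 (m / 2))

%2≡1⇒odd : ∀ m → m % 2 ≡ 1 → Odd (+ m)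
%2≡1⇒odd m m%2≡1 = + (m / 2) ,
  trans (cong +_ (trans (m%n≡r⇒m≡r+[m/n]*n m 2 m%2≡1) (cong suc (ℕ.*-comm (m / 2) 2))))
        (cong (_+_ (+ 1)) (pos-* 2 (m / 2)))

¬2∣⇒odd : ∀ k → ¬ (+ 2 ∣ k) → Odd k
¬2∣⇒odd k 2∤k with k ℤ.% + 2 | ℤ.a≡a%n+[a/n]*n k (+ 2) | ℤ.n%d<d k (+ 2)
... | 0           | k≡ | _ = ⊥-elim (2∤k (∣⇒∣ᵤ (divides (k ℤ./ + 2) (trans k≡ (+-identityˡ _)))))
... | 1           | k≡ | _ = k ℤ./ + 2 , trans k≡ (cong (_+_ (+ 1)) (*-comm (k ℤ./ + 2) (+ 2)))
... | suc (suc _) | _  | ℕ.s≤s (ℕ.s≤s ())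

discriminant-identity : ∀ A B C k → C * A - B * B ≡ + 1 →
  let s = B * A + k * C
      t = - (A * A) - k * B
  in (s * s - + 4 * t) * (C * C) ≡ (C * s + + 2 * B) * (C * s + + 2 * B) + + 4
discriminant-identity A B C k CA-B²≡1 = begin
  (s * s - + 4 * t) * (C * C)
    ≡⟨ expand A B C k ⟩
  T * T + + 4 * (A * C) * (C * A - B * B) - + 4 * (B * B)
    ≡⟨ cong (λ z → T * T + + 4 * (A * C) * z - + 4 * (B * B)) CA-B²≡1 ⟩
  T * T + + 4 * (A * C) * + 1 - + 4 * (B * B)
    ≡⟨ regroup A B C T ⟩
  T * T + + 4 * (C * A - B * B)
    ≡⟨ cong (λ z → T * T + + 4 * z) CA-B²≡1 ⟩
  T * T + + 4 ∎
  where
  open ≡-Reasoning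
  s t T : ℤ
  s = B * A + k * C
  t = - (A * A) - k * B
  T = C * s + + 2 * B
  expand : ∀ A B C k →
    ((B * A + k * C) * (B * A + k * C) - + 4 * (- (A * A) - k * B)) * (C * C)
      ≡ (C * (B * A + k * C) + + 2 * B) * (C * (B * A + k * C) + + 2 * B)
        + + 4 * (A * C) * (C * A - B * B) - + 4 * (B * B)
  expand A B C k = solve (A ∷ B ∷ C ∷ k ∷ [])
  regroup : ∀ A B C T → T * T + + 4 * (A * C) * + 1 - + 4 * (B * B) ≡ T * T + + 4 * (C * A - B * B)
  regroup A B C T = solve (A ∷ B ∷ C ∷ T ∷ [])

C²<T : ∀ {M A E B C} k → B ≡ M * A + E → C ≡ M * B + A → C * A - B * B ≡ + 1 →
       - E + + 1 ≤ k → + 0 < M → + 0 < C → + 0 ≤ B →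
       C * C < C * (B * A + k * C) + + 2 * B
C²<T {M} {A} {E} {B} {C} k B≡ C≡ CA-B²≡1 k-bound 0<M 0<C 0≤B =
  0<j-i⇒i<j (subst (+ 0 <_) (sym T-C²≡)
    (+-mono-<-≤ (+-mono-≤-< (0≤i*j 0≤k+E-1 (0≤i*i C)) (0<i*j (0<i*j 0<M 0<C) (+<+ (ℕ.s≤s ℕ.z≤n))))
                (0≤i*j {+ 2} (+≤+ ℕ.z≤n) 0≤B)))
  where
  gap : ∀ {B C} → B ≡ M * A + E → C ≡ M * B + A →
        C * (B * A + k * C) + + 2 * B - C * C ≡ (k + E - + 1) * (C * C) + M * C * (C * A - B * B) + + 2 * B
  gap refl refl = solve (M ∷ A ∷ E ∷ k ∷ [])
  T-C²≡ : C * (B * A + k * C) + + 2 * B - C * C ≡ (k + E - + 1) * (C * C) + M * C * + 1 + + 2 * B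
  T-C²≡ = trans (gap B≡ C≡) (cong (λ z → (k + E - + 1) * (C * C) + M * C * z + + 2 * B) CA-B²≡1)
  0≤k+E-1 : + 0 ≤ k + E - + 1
  0≤k+E-1 = subst (+ 0 ≤_) (regroup k E) (i≤j⇒0≤j-i k-bound)
    where
    regroup : ∀ k E → k - (- E + + 1) ≡ k + E - + 1
    regroup k E = solve (k ∷ E ∷ [])

module FibonacciFamily (m h : ℕ) (k : ℤ) (1≤m : 1 ℕ.≤ m) (h-even : h % 2 ≡ 0)
                       (k-bound : - fib (+ m) h + + 1 ≤ k) where
  M A B C s t D T : ℤ
  M = + m
  A = fib M (suc h)
  B = fib M (suc (suc h))
  C = fib M (suc (suc (suc h)))
  s = B * A + k * C
  t = - (A * A) - k * B
  D = s * s - + 4 * t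
  T = C * s + + 2 * B

  CA-B²≡1 : C * A - B * B ≡ + 1
  CA-B²≡1 = cassini M h h-even

  open MinimalSolution D C T (discriminant-identity A B C k CA-B²≡1) (fib-pos 1≤m (suc (suc h)))
         (C²<T k refl refl CA-B²≡1 k-bound (+<+ 1≤m) (fib-pos 1≤m (suc (suc h))) (fib-nonneg m (suc (suc h))))
    public

  T-odd : Odd k → Even (B * A) → Odd C → Odd T
  T-odd k-odd BA-even C-odd =
    odd+even (odd*odd C-odd (even+odd BA-even (odd*odd k-odd C-odd))) (B , refl)

  T-even : Even C → Even T
  T-even C-even = even+even (even* C-even) (B , refl)

theorem4p2 : (m n : ℕ) (k : ℤ) → 1 Data.Nat.≤ m → 1 Data.Nat.≤ n → n % 2 ≡ 0 →
  ¬ ((+ 2) ∣ k) → - fib (+ m) (n ∸ 2) + + 1 ≤ k →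
  let s = fib (+ m) n * fib (+ m) (n ∸ 1) + k * fib (+ m) (suc n)
      t = - (fib (+ m) (n ∸ 1) * fib (+ m) (n ∸ 1)) - k * fib (+ m) n
      D = s * s - + 4 * t
      T = fib (+ m) (suc n) * s + + 2 * fib (+ m) n
  in (x y : ℤ) → IsMinimalSol D (- + 1) x y →
    (m % 2 ≡ 0 →
      (+ 2 * x ≡ (T * T + + 3) * T) × (+ 2 * y ≡ (T * T + + 1) * fib (+ m) (suc n)))
    × (m % 2 ≡ 1 → (n % 6 ≡ 0 ⊎ n % 6 ≡ 4) →
      (+ 2 * x ≡ (T * T + + 3) * T) × (+ 2 * y ≡ (T * T + + 1) * fib (+ m) (suc n)))
    × (m % 2 ≡ 1 → n % 6 ≡ 2 →
      (+ 2 * x ≡ T) × (+ 2 * y ≡ fib (+ m) (suc n)))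
theorem4p2 m zero       _ _ ()
theorem4p2 m (suc zero) _ _ _ ()
theorem4p2 m n@(suc (suc h)) k 1≤m _ n-even 2∤k k-bound x y minimal =
    (λ m-even → let B-even , C-odd = fib-parity-M-even (%2≡0⇒even m m-even) n n-even
                in T-odd-case (even* B-even) C-odd)
  , (λ where
       m-odd (inj₁ n%6≡0) →
         let B-even , C-odd , _ = fib-parity-M-odd (%2≡1⇒odd m m-odd) (3∣j+n n 0 n%6≡0 (ℕ.divides 0 refl))
         in T-odd-case (even* B-even) C-odd
       m-odd (inj₂ n%6≡4) →
         -- 3 ∣ 2 + n = 3 + (n − 1), hence 3 ∣ n − 1
         let A-even , _ , C-odd = fib-parity-M-odd (%2≡1⇒odd m m-odd)
                                    (ℕ.∣m+n∣m⇒∣n (3∣j+n n 2 n%6≡4 (ℕ.divides 2 refl)) ℕ.∣-refl)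
         in T-odd-case (*even {B} A-even) C-odd)
  , (λ m-odd n%6≡2 →
       let C-even , _ = fib-parity-M-odd (%2≡1⇒odd m m-odd) (3∣j+n n 1 n%6≡2 (ℕ.divides 1 refl))
       in minimal-solution-even (T-even C-even) C-even minimal)
  where
  open FibonacciFamily m h k 1≤m n-even k-bound

  T-odd-case : Even (B * A) → Odd C →
               (+ 2 * x ≡ (T * T + + 3) * T) × (+ 2 * y ≡ (T * T + + 1) * C)
  T-odd-case BA-even C-odd = minimal-solution-odd (T-odd (¬2∣⇒odd k 2∤k) BA-even C-odd) minimal
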